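{- Let $e\ge0$ and $n\ge 2$ be integers, let $x_{n-1}\in\mathrm{GF}(2^{2\cdot3^{n-1}})$, and put $f(x,y)=y^3+y+x^{2^e}$. Assume that $f(x_{n-1},y)$ splits into linear factors in $\mathrm{GF}(2^{2\cdot3^{n}})[y]$, and let $x_n\in\mathrm{GF}(2^{2\cdot3^{n}})$ be one of its roots. Then $f(x_n,y)$ splits into linear factors in $\mathrm{GF}(2^{2\cdot3^{n+1}})[y]$.
   Context: $\mathrm{GF}(2^m)$ denotes the field with $2^m$ elements, all inside a fixed algebraic closure of $\mathrm{GF}(2)$. -}

module Defs where

open import Level using (Level; Lift; _⊔_)
open import Data.Unit.Polymorphic using (⊤)
open import Data.Nat using (ℕ; zero; suc; _^_)
open import Data.Product using (_×_; ∃)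
open import Data.List using (List; []; _∷_; map; _∷ʳ_)
open import Data.List.Relation.Unary.All using (All)
open import Relation.Nullary using (¬_)
open import Algebra.Bundles using (CommutativeRing)

module _ {c ℓ : Level} (R : CommutativeRing c ℓ) where
  open CommutativeRing R

  pow : Carrier → ℕ → Carrier
  pow x zero = 1#
  pow x (suc k) = x * pow x k

  IsField : Set (c ⊔ ℓ)
  IsField = (¬ (0# ≈ 1#)) × (∀ x → ¬ (x ≈ 0#) → ∃ λ y → (x * y) ≈ 1#)

  CharTwo : Set ℓ
  CharTwo = (1# + 1#) ≈ 0#

  -- polynomials as coefficient lists, constant coefficient first
  Poly : Set c
  Poly = List Carrier

  eval : Poly → Carrier → Carrier
  eval [] x = 0#
  eval (a ∷ p) x = a + (x * eval p x)

  _+ₚ_ : Poly → Poly → Poly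
  [] +ₚ q = q
  (a ∷ p) +ₚ [] = a ∷ p
  (a ∷ p) +ₚ (b ∷ q) = (a + b) ∷ (p +ₚ q)

  _*ₚ_ : Poly → Poly → Poly
  [] *ₚ q = []
  (a ∷ p) *ₚ q = map (a *_) q +ₚ (0# ∷ (p *ₚ q))

  -- equality of polynomials (coefficientwise, up to trailing zeros)
  _≈ₚ_ : Poly → Poly → Set ℓ
  [] ≈ₚ [] = ⊤
  [] ≈ₚ (b ∷ q) = (b ≈ 0#) × ([] ≈ₚ q)
  (a ∷ p) ≈ₚ [] = (a ≈ 0#) × (p ≈ₚ [])
  (a ∷ p) ≈ₚ (b ∷ q) = (a ≈ b) × (p ≈ₚ q)

  -- algebraically closed: every polynomial of degree ≥ 1 has a root
  AlgClosed : Set (c ⊔ ℓ)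
  AlgClosed = ∀ (a₀ : Carrier) (as : List Carrier) (lead : Carrier) →
              ¬ (lead ≈ 0#) → ∃ λ x → eval ((a₀ ∷ as) ∷ʳ lead) x ≈ 0#

  -- membership in GF(2^m) inside the (algebraically closed) field: x^(2^m) = x
  GF : ℕ → Carrier → Set ℓ
  GF m x = pow x (2 ^ m) ≈ x

  linear : Carrier → Poly
  linear r = (- r) ∷ 1# ∷ []

  prodLinear : List Carrier → Poly
  prodLinear [] = 1# ∷ []
  prodLinear (r ∷ rs) = linear r *ₚ prodLinear rs

  SplitsIn : Poly → ℕ → Set (c ⊔ ℓ)
  SplitsIn p m = ∃ λ rs → All (GF m) rs × (p ≈ₚ prodLinear rs)

  f : ℕ → Carrier → Poly
  f e x = pow x (2 ^ e) ∷ 1# ∷ 0# ∷ 1# ∷ []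

module Submission where

-- Put q = 2 ^ m with m = 2 · 3ⁿ, so q ≡ 1 (mod 3) and GF(q) contains a root ω of ω² + ω + 1.
-- As xₙ is one of the three roots of f(xₙ₋₁, y) in GF(q), the quotient y² + xₙ y + xₙ² + 1 of
-- f(xₙ₋₁, y) by y − xₙ has a root y ∈ GF(q), and s = ω² xₙ + y satisfies s (s + xₙ) = 1, so
-- xₙ = s + s⁻¹. By Frobenius the constant term of f(xₙ, z) is r + r⁻¹ with r = s ^ 2 ^ e ∈ GF(q),
-- and Cardano's formula gives its roots ωⁱ t + ω⁻ⁱ t⁻¹ with t³ = r. Finally t ∈ GF(q³): the
-- q-Frobenius multiplies t by the cube root of unity r ^ ((q − 1) / 3) ∈ GF(q), so its third
-- iterate fixes t.

open import Defs
open import Level using (Level; 0ℓ; _⊔_)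
open import Algebra.Bundles using (CommutativeRing; RawRing)
open import Algebra.Solver.Ring.AlmostCommutativeRing using (_-Raw-AlmostCommutative⟶_; fromCommutativeRing)
open import Data.Bool using (Bool; true; false; _xor_; _∧_)
import Data.Bool.Properties as Bool
open import Data.Maybe as Maybe using (Maybe)
open import Relation.Nullary.Decidable using (dec⇒maybe)
open import Data.Nat using (ℕ; zero; suc)
import Data.Nat as ℕ
import Data.Nat.Properties as ℕ
import Algebra.Properties.CommutativeSemiring.Exp
open import Data.Product using (_×_; _,_; ∃; ∃₂)
open import Data.Empty using (⊥-elim)
open import Data.Unit.Polymorphic using (tt)
open import Data.List.Relation.Unary.All using ([]; _∷_)
open import Data.List using ([]; _∷_; length; map)
open import Relation.Binary.PropositionalEquality as ≡ using (_≡_)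
open import Function using (_∘_)

module Powers {c ℓ} (K : CommutativeRing c ℓ) where
  open CommutativeRing K hiding (zero)
  private module Exp = Algebra.Properties.CommutativeSemiring.Exp commutativeSemiring
  open import Relation.Binary.Reasoning.Setoid setoid

  infixr 8 _^_
  _^_ : Carrier → ℕ → Carrier
  _^_ = pow K

  ^≡Exp^ : ∀ x n → x ^ n ≡ x Exp.^ n
  ^≡Exp^ x zero = ≡.refl
  ^≡Exp^ x (suc n) = ≡.cong (x *_) (^≡Exp^ x n)

  ^-congˡ : ∀ n {x y} → x ≈ y → x ^ n ≈ y ^ n
  ^-congˡ n {x} {y} x≈y rewrite ^≡Exp^ x n | ^≡Exp^ y n = Exp.^-congˡ n x≈y

  ^-assocʳ : ∀ x m n → (x ^ m) ^ n ≈ x ^ (m ℕ.* n)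
  ^-assocʳ x m n rewrite ^≡Exp^ x m | ^≡Exp^ (x Exp.^ m) n | ^≡Exp^ x (m ℕ.* n) = Exp.^-assocʳ x m n

  ^-distrib-* : ∀ x y n → (x * y) ^ n ≈ x ^ n * y ^ n
  ^-distrib-* x y n rewrite ^≡Exp^ (x * y) n | ^≡Exp^ x n | ^≡Exp^ y n = Exp.^-distrib-* x y n

  1^n≈1 : ∀ n → 1# ^ n ≈ 1#
  1^n≈1 zero = refl
  1^n≈1 (suc n) = trans (*-identityˡ _) (1^n≈1 n)

  ^-comm : ∀ x m n → (x ^ m) ^ n ≈ (x ^ n) ^ m
  ^-comm x m n = begin
    (x ^ m) ^ n    ≈⟨ ^-assocʳ x m n ⟩
    x ^ (m ℕ.* n)  ≡⟨ ≡.cong (x ^_) (ℕ.*-comm m n) ⟩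
    x ^ (n ℕ.* m)  ≈⟨ ^-assocʳ x n m ⟨
    (x ^ n) ^ m    ∎

  x^[1+d*k]≈x*[x^d]^k : ∀ x d k → x ^ suc (d ℕ.* k) ≈ x * (x ^ d) ^ k
  x^[1+d*k]≈x*[x^d]^k x d k = *-congˡ (sym (^-assocʳ x d k))

  x^j-idempotent : ∀ {x} j → x ^ suc j ≈ x → x ^ j * x ^ j ≈ x ^ j
  x^j-idempotent zero _ = *-identityˡ 1#
  x^j-idempotent {x} (suc i) x^q≈x = begin
    (x * x ^ i) * x ^ suc i  ≈⟨ *-congʳ (*-comm x _) ⟩
    (x ^ i * x) * x ^ suc i  ≈⟨ *-assoc _ x _ ⟩
    x ^ i * x ^ suc (suc i)  ≈⟨ *-congˡ x^q≈x ⟩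
    x ^ i * x                ≈⟨ *-comm _ x ⟩
    x * x ^ i                ∎

  GF-⊆-+ : ∀ a b {x} → GF K a x → GF K b x → GF K (a ℕ.+ b) x
  GF-⊆-+ a b {x} x∈GFa x∈GFb = begin
    x ^ 2 ℕ.^ (a ℕ.+ b)          ≡⟨ ≡.cong (x ^_) (ℕ.^-distribˡ-+-* 2 a b) ⟩
    x ^ (2 ℕ.^ a ℕ.* 2 ℕ.^ b)    ≈⟨ ^-assocʳ x (2 ℕ.^ a) (2 ℕ.^ b) ⟨
    (x ^ 2 ℕ.^ a) ^ 2 ℕ.^ b      ≈⟨ ^-congˡ (2 ℕ.^ b) x∈GFa ⟩
    x ^ 2 ℕ.^ b                  ≈⟨ x∈GFb ⟩
    x                            ∎

  module Subfield (m : ℕ) where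

    GF-1 : GF K m 1#
    GF-1 = 1^n≈1 (2 ℕ.^ m)

    GF-* : ∀ {x y} → GF K m x → GF K m y → GF K m (x * y)
    GF-* {x} {y} x∈GF y∈GF = trans (^-distrib-* x y (2 ℕ.^ m)) (*-cong x∈GF y∈GF)

    GF-^ : ∀ {x} n → GF K m x → GF K m (x ^ n)
    GF-^ {x} n x∈GF = trans (^-comm x n (2 ℕ.^ m)) (^-congˡ n x∈GF)

    GF-⊆-* : ∀ i {x} → GF K m x → GF K (i ℕ.* m) x
    GF-⊆-* zero _ = *-identityʳ _
    GF-⊆-* (suc i) x∈GF = GF-⊆-+ m (i ℕ.* m) x∈GF (GF-⊆-* i x∈GF)

    root-of-unity-∈GF : ∀ d {k ζ} → 2 ℕ.^ m ≡ suc (d ℕ.* k) → ζ ^ d ≈ 1# → GF K m ζ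
    root-of-unity-∈GF d {k} {ζ} q≡ ζ^d≈1 = begin
      ζ ^ 2 ℕ.^ m        ≡⟨ ≡.cong (ζ ^_) q≡ ⟩
      ζ ^ suc (d ℕ.* k)  ≈⟨ x^[1+d*k]≈x*[x^d]^k ζ d k ⟩
      ζ * (ζ ^ d) ^ k    ≈⟨ *-congˡ (trans (^-congˡ k ζ^d≈1) (1^n≈1 k)) ⟩
      ζ * 1#             ≈⟨ *-identityʳ ζ ⟩
      ζ                  ∎

    -- With R = r ^ k, the Frobenius x ↦ x ^ 2 ^ m multiplies t by the d-th root of unity R ∈ GF(2^m).
    root-of-unit-∈GF : ∀ d {k r r′ t} → 2 ℕ.^ m ≡ suc (d ℕ.* k) → GF K m r → r′ * r ≈ 1# → t ^ d ≈ r →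
                       GF K (d ℕ.* m) t
    root-of-unit-∈GF d {k} {r} {r′} {t} q≡ r∈GF r′r≈1 t^d≈r =
      trans (frobenius-iterate d) (trans (*-congˡ R^d≈1) (*-identityʳ t))
      where
      R : Carrier
      R = r ^ k

      t^q≈tR : t ^ 2 ℕ.^ m ≈ t * R
      t^q≈tR = trans (reflexive (≡.cong (t ^_) q≡))
                     (trans (x^[1+d*k]≈x*[x^d]^k t d k) (*-congˡ (^-congˡ k t^d≈r)))

      rR^d≈r : r * R ^ d ≈ r
      rR^d≈r = begin
        r * (r ^ k) ^ d    ≈⟨ *-congˡ (^-comm r k d) ⟩
        r * (r ^ d) ^ k    ≈⟨ x^[1+d*k]≈x*[x^d]^k r d k ⟨
        r ^ suc (d ℕ.* k)  ≡⟨ ≡.cong (r ^_) q≡ ⟨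
        r ^ 2 ℕ.^ m        ≈⟨ r∈GF ⟩
        r                  ∎

      R^d≈1 : R ^ d ≈ 1#
      R^d≈1 = begin
        R ^ d              ≈⟨ *-identityˡ _ ⟨
        1# * R ^ d         ≈⟨ *-congʳ r′r≈1 ⟨
        (r′ * r) * R ^ d   ≈⟨ *-assoc r′ r _ ⟩
        r′ * (r * R ^ d)   ≈⟨ *-congˡ rR^d≈r ⟩
        r′ * r             ≈⟨ r′r≈1 ⟩
        1#                 ∎

      frobenius-iterate : ∀ i → t ^ 2 ℕ.^ (i ℕ.* m) ≈ t * R ^ i
      frobenius-iterate zero = refl
      frobenius-iterate (suc i) = begin
        t ^ 2 ℕ.^ (m ℕ.+ i ℕ.* m)                      ≡⟨ ≡.cong (t ^_) (ℕ.^-distribˡ-+-* 2 m (i ℕ.* m)) ⟩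
        t ^ (2 ℕ.^ m ℕ.* 2 ℕ.^ (i ℕ.* m))              ≈⟨ ^-assocʳ t (2 ℕ.^ m) q′ ⟨
        (t ^ 2 ℕ.^ m) ^ q′                             ≈⟨ ^-congˡ q′ t^q≈tR ⟩
        (t * R) ^ q′                                   ≈⟨ ^-distrib-* t R q′ ⟩
        t ^ q′ * R ^ q′                                ≈⟨ *-cong (frobenius-iterate i) (GF-⊆-* i (GF-^ k r∈GF)) ⟩
        (t * R ^ i) * R                                ≈⟨ *-assoc t _ R ⟩
        t * (R ^ i * R)                                ≈⟨ *-congˡ (*-comm _ R) ⟩
        t * R ^ suc i                                  ∎
        where
        q′ : ℕ
        q′ = 2 ℕ.^ (i ℕ.* m)

module Coefficients {c ℓ} (K : CommutativeRing c ℓ) where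
  open CommutativeRing K hiding (zero)
  open import Relation.Binary.Reasoning.Setoid setoid

  coeff : Poly K → ℕ → Carrier
  coeff [] _ = 0#
  coeff (a ∷ p) zero = a
  coeff (a ∷ p) (suc i) = coeff p i

  coeff-cong : ∀ p q → _≈ₚ_ K p q → ∀ i → coeff p i ≈ coeff q i
  coeff-cong [] [] _ _ = refl
  coeff-cong [] (b ∷ q) (b≈0 , _) zero = sym b≈0
  coeff-cong [] (b ∷ q) (_ , []≈q) (suc i) = coeff-cong [] q []≈q i
  coeff-cong (a ∷ p) [] (a≈0 , _) zero = a≈0
  coeff-cong (a ∷ p) [] (_ , p≈[]) (suc i) = coeff-cong p [] p≈[] i
  coeff-cong (a ∷ p) (b ∷ q) (a≈b , _) zero = a≈b
  coeff-cong (a ∷ p) (b ∷ q) (_ , p≈q) (suc i) = coeff-cong p q p≈q i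

  coeff-+ₚ : ∀ p q i → coeff (_+ₚ_ K p q) i ≈ coeff p i + coeff q i
  coeff-+ₚ [] q i = sym (+-identityˡ _)
  coeff-+ₚ (a ∷ p) [] i = sym (+-identityʳ _)
  coeff-+ₚ (a ∷ p) (b ∷ q) zero = refl
  coeff-+ₚ (a ∷ p) (b ∷ q) (suc i) = coeff-+ₚ p q i

  coeff-map : ∀ a p i → coeff (map (a *_) p) i ≈ a * coeff p i
  coeff-map a [] i = sym (zeroʳ a)
  coeff-map a (b ∷ p) zero = refl
  coeff-map a (b ∷ p) (suc i) = coeff-map a p i

  coeff-linear-*ₚ : ∀ r p i → coeff (_*ₚ_ K (linear K r) p) (suc i) ≈ - r * coeff p (suc i) + coeff p i
  coeff-linear-*ₚ r p i = begin
    coeff (_*ₚ_ K (linear K r) p) (suc i)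
      ≈⟨ coeff-+ₚ (map (- r *_) p) _ (suc i) ⟩
    coeff (map (- r *_) p) (suc i) + coeff (_+ₚ_ K (map (1# *_) p) (0# ∷ [])) i
      ≈⟨ +-cong (coeff-map (- r) p (suc i)) (coeff-+ₚ (map (1# *_) p) (0# ∷ []) i) ⟩
    - r * coeff p (suc i) + (coeff (map (1# *_) p) i + coeff (0# ∷ []) i)
      ≈⟨ +-congˡ (+-cong (coeff-map 1# p i) (coeff-0∷[] i)) ⟩
    - r * coeff p (suc i) + (1# * coeff p i + 0#)
      ≈⟨ +-congˡ (trans (+-identityʳ _) (*-identityˡ _)) ⟩
    - r * coeff p (suc i) + coeff p i
      ∎
    where
    coeff-0∷[] : ∀ i → coeff (0# ∷ []) i ≈ 0#
    coeff-0∷[] zero = refl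
    coeff-0∷[] (suc i) = refl

  coeff-prodLinear-beyond : ∀ rs k → coeff (prodLinear K rs) (suc k ℕ.+ length rs) ≈ 0#
  coeff-prodLinear-beyond [] k = refl
  coeff-prodLinear-beyond (r ∷ rs) k rewrite ℕ.+-suc k (length rs) = begin
    coeff (prodLinear K (r ∷ rs)) (suc (suc k ℕ.+ n))          ≈⟨ coeff-linear-*ₚ r P (suc k ℕ.+ n) ⟩
    - r * coeff P (suc (suc k) ℕ.+ n) + coeff P (suc k ℕ.+ n)  ≈⟨ +-cong (*-congˡ (coeff-prodLinear-beyond rs (suc k)))
                                                                         (coeff-prodLinear-beyond rs k) ⟩
    - r * 0# + 0#                                              ≈⟨ trans (+-identityʳ _) (zeroʳ _) ⟩
    0#                                                         ∎
    where
    P : Poly K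
    P = prodLinear K rs
    n : ℕ
    n = length rs

  coeff-prodLinear-length : ∀ rs → coeff (prodLinear K rs) (length rs) ≈ 1#
  coeff-prodLinear-length [] = refl
  coeff-prodLinear-length (r ∷ rs) = begin
    coeff (prodLinear K (r ∷ rs)) (suc n)   ≈⟨ coeff-linear-*ₚ r P n ⟩
    - r * coeff P (suc n) + coeff P n       ≈⟨ +-cong (*-congˡ (coeff-prodLinear-beyond rs 0)) (coeff-prodLinear-length rs) ⟩
    - r * 0# + 1#                           ≈⟨ trans (+-congʳ (zeroʳ _)) (+-identityˡ _) ⟩
    1#                                      ∎
    where
    P : Poly K
    P = prodLinear K rs
    n : ℕ
    n = length rs

module CharacteristicTwo {a ℓ} (K : CommutativeRing a ℓ) (char2 : CharTwo K) where
  open CommutativeRing K hiding (zero)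
  open Powers K
  open Coefficients K
  open import Relation.Binary.Reasoning.Setoid setoid
  open import Algebra.Properties.Ring ring using (-0#≈0#)
  open import Algebra.Properties.Group +-group using (inverseˡ-unique)

  -- The ring solver with coefficients in 𝔽₂ also proves the identities that hold only in characteristic 2.
  𝔽₂ : RawRing 0ℓ 0ℓ
  𝔽₂ = record { Carrier = Bool ; _≈_ = _≡_ ; _+_ = _xor_ ; _*_ = _∧_ ; -_ = λ b → b ; 0# = false ; 1# = true }

  ⟦_⟧₂ : Bool → Carrier
  ⟦ false ⟧₂ = 0#
  ⟦ true ⟧₂ = 1#

  𝔽₂⟶K : 𝔽₂ -Raw-AlmostCommutative⟶ fromCommutativeRing K
  𝔽₂⟶K = record
    { ⟦_⟧ = ⟦_⟧₂
    ; +-homo = λ { false _ → sym (+-identityˡ _) ; true false → sym (+-identityʳ _) ; true true → sym char2 }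
    ; *-homo = λ { false _ → sym (zeroˡ _) ; true _ → sym (*-identityˡ _) }
    ; -‿homo = λ { false → sym -0#≈0# ; true → inverseˡ-unique 1# 1# char2 }
    ; 0-homo = refl
    ; 1-homo = refl
    }

  ⟦⟧₂-≟ : ∀ a b → Maybe (⟦ a ⟧₂ ≈ ⟦ b ⟧₂)
  ⟦⟧₂-≟ a b = Maybe.map (λ { ≡.refl → refl }) (dec⇒maybe (a Bool.≟ b))

  open import Algebra.Solver.Ring 𝔽₂ (fromCommutativeRing K) 𝔽₂⟶K ⟦⟧₂-≟
    using (Polynomial; solve; _:=_; _:+_; _:*_; :-_; con)

  :0 :1 : ∀ {n} → Polynomial n
  :0 = con false
  :1 = con true

  x+x≈0 : ∀ x → x + x ≈ 0#
  x+x≈0 = solve 1 (λ x → x :+ x := :0) refl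

  x+y≈0⇒x≈y : ∀ {x y} → x + y ≈ 0# → x ≈ y
  x+y≈0⇒x≈y {x} {y} x+y≈0 = begin
    x          ≈⟨ solve 2 (λ x y → x := x :+ y :+ y) refl x y ⟩
    x + y + y  ≈⟨ +-congʳ x+y≈0 ⟩
    0# + y     ≈⟨ +-identityˡ y ⟩
    y          ∎

  x≈y⇒x+y≈0 : ∀ {x y} → x ≈ y → x + y ≈ 0#
  x≈y⇒x+y≈0 {x} {y} x≈y = trans (+-congʳ x≈y) (x+x≈0 y)

  infixl 6 _+₀_
  _+₀_ : ∀ {x y} → x ≈ 0# → y ≈ 0# → x + y ≈ 0#
  x≈0 +₀ y≈0 = trans (+-cong x≈0 y≈0) (+-identityʳ 0#)

  infixr 7 _*₀_
  _*₀_ : ∀ a {x} → x ≈ 0# → a * x ≈ 0#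
  a *₀ x≈0 = trans (*-congˡ x≈0) (zeroʳ a)

  ≈-modulo : ∀ {x y z} → x ≈ y + z → z ≈ 0# → x ≈ y
  ≈-modulo x≈y+z z≈0 = trans x≈y+z (trans (+-congˡ z≈0) (+-identityʳ _))

  frobenius : ∀ x y e → (x + y) ^ 2 ℕ.^ e ≈ x ^ 2 ℕ.^ e + y ^ 2 ℕ.^ e
  frobenius x y zero = distribʳ 1# x y
  frobenius x y (suc e) = begin
    (x + y) ^ 2 ℕ.^ suc e                  ≈⟨ ^-assocʳ (x + y) 2 (2 ℕ.^ e) ⟨
    ((x + y) ^ 2) ^ 2 ℕ.^ e                ≈⟨ ^-congˡ (2 ℕ.^ e) (square-+ x y) ⟩
    (x ^ 2 + y ^ 2) ^ 2 ℕ.^ e              ≈⟨ frobenius (x ^ 2) (y ^ 2) e ⟩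
    (x ^ 2) ^ 2 ℕ.^ e + (y ^ 2) ^ 2 ℕ.^ e  ≈⟨ +-cong (^-assocʳ x 2 (2 ℕ.^ e)) (^-assocʳ y 2 (2 ℕ.^ e)) ⟩
    x ^ 2 ℕ.^ suc e + y ^ 2 ℕ.^ suc e      ∎
    where
    square-+ : ∀ x y → (x + y) ^ 2 ≈ x ^ 2 + y ^ 2
    square-+ = solve 2 (λ x y → (x :+ y) :* ((x :+ y) :* :1) := x :* (x :* :1) :+ y :* (y :* :1)) refl

  module Subfield₂ (m : ℕ) where
    open Subfield m public

    GF-+ : ∀ {x y} → GF K m x → GF K m y → GF K m (x + y)
    GF-+ {x} {y} x∈GF y∈GF = trans (frobenius x y m) (+-cong x∈GF y∈GF)

  cubic : Carrier → Poly K
  cubic c = c ∷ 1# ∷ 0# ∷ 1# ∷ []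

  -- Vieta's formulas for the roots of y³ + y + c; in characteristic 2 no signs appear.
  record CubicRoots (c r₁ r₂ r₃ : Carrier) : Set ℓ where
    field
      e₁≈0 : r₁ + r₂ + r₃ ≈ 0#
      e₂≈1 : r₁ * r₂ + r₁ * r₃ + r₂ * r₃ ≈ 1#
      e₃≈c : r₁ * r₂ * r₃ ≈ c

  -- The left-hand sides are the unsimplified coefficients computed by prodLinear.
  coeff-prodLinear₃ : ∀ a b d → let p = prodLinear K (a ∷ b ∷ d ∷ []) in
    coeff p 0 ≈ a * b * d × coeff p 1 ≈ a * b + a * d + b * d × coeff p 2 ≈ a + b + d × coeff p 3 ≈ 1#
  coeff-prodLinear₃ a b d =
    solve 3 (λ a b d → (:- a) :* ((:- b) :* ((:- d) :* :1 :+ :0) :+ :0) :+ :0 := a :* b :* d) refl a b d ,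
    solve 3 (λ a b d → (:- a) :* ((:- b) :* (:1 :* :1 :+ :0) :+ (:1 :* ((:- d) :* :1 :+ :0) :+ :0))
                       :+ (:1 :* ((:- b) :* ((:- d) :* :1 :+ :0) :+ :0) :+ :0)
                       := a :* b :+ a :* d :+ b :* d) refl a b d ,
    solve 3 (λ a b d → (:- a) :* (:1 :* (:1 :* :1 :+ :0))
                       :+ :1 :* ((:- b) :* (:1 :* :1 :+ :0) :+ (:1 :* ((:- d) :* :1 :+ :0) :+ :0))
                       := a :+ b :+ d) refl a b d ,
    solve 0 (:1 :* (:1 :* (:1 :* :1 :+ :0)) := :1) refl

  cubic≈prodLinear⇒roots : ∀ {c a b d} → _≈ₚ_ K (cubic c) (prodLinear K (a ∷ b ∷ d ∷ [])) → CubicRoots c a b d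
  cubic≈prodLinear⇒roots {a = a} {b} {d} (c≈p₀ , 1≈p₁ , 0≈p₂ , _) =
    let (p₀≈e₃ , p₁≈e₂ , p₂≈e₁ , _) = coeff-prodLinear₃ a b d in record
      { e₁≈0 = trans (sym p₂≈e₁) (sym 0≈p₂)
      ; e₂≈1 = trans (sym p₁≈e₂) (sym 1≈p₁)
      ; e₃≈c = trans (sym p₀≈e₃) (sym c≈p₀)
      }

  roots⇒cubic≈prodLinear : ∀ {c a b d} → CubicRoots c a b d → _≈ₚ_ K (cubic c) (prodLinear K (a ∷ b ∷ d ∷ []))
  roots⇒cubic≈prodLinear {a = a} {b} {d} roots =
    let (p₀≈e₃ , p₁≈e₂ , p₂≈e₁ , p₃≈1) = coeff-prodLinear₃ a b d in
    sym (trans p₀≈e₃ e₃≈c) , sym (trans p₁≈e₂ e₂≈1) , sym (trans p₂≈e₁ e₁≈0) , sym p₃≈1 , tt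
    where open CubicRoots roots

  record CubicSplitting (c : Carrier) (m : ℕ) : Set (a ⊔ ℓ) where
    field
      r₁ r₂ r₃ : Carrier
      r₁∈GF : GF K m r₁
      r₂∈GF : GF K m r₂
      r₃∈GF : GF K m r₃
      roots : CubicRoots c r₁ r₂ r₃

  splitsIn⇒cubicSplitting : 0# ≉ 1# → ∀ m {c} → SplitsIn K (cubic c) m → CubicSplitting c m
  splitsIn⇒cubicSplitting _ _ ((a ∷ b ∷ d ∷ []) , (a∈GF ∷ b∈GF ∷ d∈GF ∷ []) , c≈p) =
    record { r₁∈GF = a∈GF ; r₂∈GF = b∈GF ; r₃∈GF = d∈GF ; roots = cubic≈prodLinear⇒roots c≈p }
  splitsIn⇒cubicSplitting 0≉1 _ {c} ([] , _ , c≈p) =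
    ⊥-elim (0≉1 (sym (trans (coeff-cong (cubic c) (prodLinear K []) c≈p 3) (coeff-prodLinear-beyond [] 2))))
  splitsIn⇒cubicSplitting 0≉1 _ {c} (rs@(_ ∷ []) , _ , c≈p) =
    ⊥-elim (0≉1 (sym (trans (coeff-cong (cubic c) (prodLinear K rs) c≈p 3) (coeff-prodLinear-beyond rs 1))))
  splitsIn⇒cubicSplitting 0≉1 _ {c} (rs@(_ ∷ _ ∷ []) , _ , c≈p) =
    ⊥-elim (0≉1 (sym (trans (coeff-cong (cubic c) (prodLinear K rs) c≈p 3) (coeff-prodLinear-beyond rs 0))))
  splitsIn⇒cubicSplitting 0≉1 _ {c} (rs@(_ ∷ _ ∷ _ ∷ _ ∷ _) , _ , c≈p) =
    ⊥-elim (0≉1 (trans (coeff-cong (cubic c) (prodLinear K rs) c≈p (length rs)) (coeff-prodLinear-length rs)))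

  cubicSplitting⇒splitsIn : ∀ {c m} → CubicSplitting c m → SplitsIn K (cubic c) m
  cubicSplitting⇒splitsIn s =
    (r₁ ∷ r₂ ∷ r₃ ∷ []) , (r₁∈GF ∷ r₂∈GF ∷ r₃∈GF ∷ []) , roots⇒cubic≈prodLinear roots
    where open CubicSplitting s

  -- y is a root of (y³ + y − x³ − x) / (y − x), i.e. a root of the cubic other than x (up to multiplicity).
  CofactorRoot : Carrier → Carrier → Set ℓ
  CofactorRoot x y = y * y + x * y + x * x + 1# ≈ 0#

  -- E₁ and E₂ act as the indicators of x ≠ r₁ and x ≠ r₂, so y is the root following x in the cycle r₁ r₂ r₃.
  idempotent-selection : ∀ {c r₁ r₂ r₃ x E₁ E₂} → CubicRoots c r₁ r₂ r₃ → E₁ * E₁ ≈ E₁ → E₂ * E₂ ≈ E₂ →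
    (x + r₁) * (1# + E₁) ≈ 0# → (x + r₂) * (1# + E₂) ≈ 0# → (x + r₃) * E₁ * E₂ ≈ 0# →
    CofactorRoot x ((1# + E₁) * r₂ + E₁ * (1# + E₂) * r₃ + E₁ * E₂ * r₁)
  idempotent-selection {r₁ = r₁} {r₂} {r₃} {x} {E₁} {E₂} roots E₁²≈E₁ E₂²≈E₂
                       d₁[1+E₁]≈0 d₂[1+E₂]≈0 d₃E₁E₂≈0 =
    trans (solve 6 (λ x r₁ r₂ r₃ E₁ E₂ →
      let y = (:1 :+ E₁) :* r₂ :+ E₁ :* (:1 :+ E₂) :* r₃ :+ E₁ :* E₂ :* r₁ in
      y :* y :+ x :* y :+ x :* x :+ :1
      := ((:1 :+ E₁) :+ E₁ :* (:1 :+ E₂) :+ E₁ :* E₂) :* (r₁ :* r₂ :+ r₁ :* r₃ :+ r₂ :* r₃ :+ :1)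
      :+ ((:1 :+ E₁) :* (r₂ :+ r₁) :+ E₁ :* (:1 :+ E₂) :* (r₃ :+ r₂) :+ E₁ :* E₂ :* (r₁ :+ r₃)) :* (r₁ :+ r₂ :+ r₃)
      :+ (r₂ :+ (x :+ r₁)) :* ((x :+ r₁) :* (:1 :+ E₁))
      :+ E₁ :* (r₃ :+ (x :+ r₂)) :* ((x :+ r₂) :* (:1 :+ E₂))
      :+ (r₁ :+ (x :+ r₃)) :* ((x :+ r₃) :* E₁ :* E₂)
      :+ (r₂ :* r₂ :+ x :* x :+ (:1 :+ E₂) :* (:1 :+ E₂) :* (r₃ :* r₃ :+ x :* x) :+ E₂ :* E₂ :* (r₁ :* r₁ :+ x :* x))
         :* (E₁ :* E₁ :+ E₁)
      :+ (E₁ :* (r₃ :* r₃ :+ x :* x) :+ E₁ :* (r₁ :* r₁ :+ x :* x)) :* (E₂ :* E₂ :+ E₂)) refl x r₁ r₂ r₃ E₁ E₂)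
      (_ *₀ x≈y⇒x+y≈0 e₂≈1 +₀ _ *₀ e₁≈0 +₀ _ *₀ d₁[1+E₁]≈0 +₀ _ *₀ d₂[1+E₂]≈0 +₀ _ *₀ d₃E₁E₂≈0
        +₀ _ *₀ x≈y⇒x+y≈0 E₁²≈E₁ +₀ _ *₀ x≈y⇒x+y≈0 E₂²≈E₂)
    where open CubicRoots roots

  -- Which root x is cannot be decided, so it is selected by the idempotents (x − rᵢ) ^ (q − 1), q = 2 ^ m.
  cofactor-root-∈GF : ∀ {m i c x} → 2 ℕ.^ m ≡ suc (suc i) → CubicSplitting c m → GF K m x →
                      eval K (cubic c) x ≈ 0# → ∃ λ y → GF K m y × CofactorRoot x y
  cofactor-root-∈GF {m} {i} {c} {x} q≡ split x∈GF root =
    y , y∈GF , idempotent-selection roots (idempotent d₁∈GF) (idempotent d₂∈GF)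
                                          (annihilates d₁∈GF) (annihilates d₂∈GF) d₃E₁E₂≈0
    where
    open CubicSplitting split
    open CubicRoots roots
    open Subfield₂ m

    j : ℕ
    j = suc i

    d₁ d₂ d₃ E₁ E₂ E₃ y : Carrier
    d₁ = x + r₁
    d₂ = x + r₂
    d₃ = x + r₃
    E₁ = d₁ ^ j
    E₂ = d₂ ^ j
    E₃ = d₃ ^ j
    y = (1# + E₁) * r₂ + E₁ * (1# + E₂) * r₃ + E₁ * E₂ * r₁

    d₁∈GF : GF K m d₁
    d₁∈GF = GF-+ x∈GF r₁∈GF
    d₂∈GF : GF K m d₂
    d₂∈GF = GF-+ x∈GF r₂∈GF
    d₃∈GF : GF K m d₃
    d₃∈GF = GF-+ x∈GF r₃∈GF

    fixed : ∀ {d} → GF K m d → d ^ suc j ≈ d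
    fixed {d} d∈GF = trans (reflexive (≡.cong (d ^_) (≡.sym q≡))) d∈GF

    idempotent : ∀ {d} → GF K m d → d ^ j * d ^ j ≈ d ^ j
    idempotent d∈GF = x^j-idempotent j (fixed d∈GF)

    annihilates : ∀ {d} → GF K m d → d * (1# + d ^ j) ≈ 0#
    annihilates {d} d∈GF = begin
      d * (1# + d ^ j)  ≈⟨ solve 2 (λ d e → d :* (:1 :+ e) := d :+ d :* e) refl d (d ^ j) ⟩
      d + d ^ suc j     ≈⟨ x≈y⇒x+y≈0 (sym (fixed d∈GF)) ⟩
      0#                ∎

    d₁d₂d₃≈0 : d₁ * d₂ * d₃ ≈ 0#
    d₁d₂d₃≈0 = trans
      (solve 5 (λ x r₁ r₂ r₃ c →
        (x :+ r₁) :* (x :+ r₂) :* (x :+ r₃)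
        := (c :+ x :* (:1 :+ x :* (:0 :+ x :* (:1 :+ x :* :0)))) :+ x :* x :* (r₁ :+ r₂ :+ r₃)
           :+ x :* (r₁ :* r₂ :+ r₁ :* r₃ :+ r₂ :* r₃ :+ :1) :+ (r₁ :* r₂ :* r₃ :+ c)) refl x r₁ r₂ r₃ c)
      (root +₀ _ *₀ e₁≈0 +₀ _ *₀ x≈y⇒x+y≈0 e₂≈1 +₀ x≈y⇒x+y≈0 e₃≈c)

    d₃E₁E₂≈0 : d₃ * E₁ * E₂ ≈ 0#
    d₃E₁E₂≈0 = begin
      d₃ * E₁ * E₂               ≈⟨ *-congʳ (*-congʳ (fixed d₃∈GF)) ⟨
      d₃ * E₃ * E₁ * E₂          ≈⟨ solve 4 (λ d E₁ E₂ E₃ → d :* E₃ :* E₁ :* E₂ := d :* (E₁ :* E₂ :* E₃))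
                                          refl d₃ E₁ E₂ E₃ ⟩
      d₃ * (E₁ * E₂ * E₃)        ≈⟨ *-congˡ (trans (^-distrib-* (d₁ * d₂) d₃ j) (*-congʳ (^-distrib-* d₁ d₂ j))) ⟨
      d₃ * (d₁ * d₂ * d₃) ^ j    ≈⟨ *-congˡ (^-congˡ j d₁d₂d₃≈0) ⟩
      d₃ * 0# ^ j                ≈⟨ d₃ *₀ zeroˡ _ ⟩
      0#                         ∎

    y∈GF : GF K m y
    y∈GF = GF-+ (GF-+ (GF-* (GF-+ GF-1 E₁∈GF) r₂∈GF) (GF-* (GF-* E₁∈GF (GF-+ GF-1 E₂∈GF)) r₃∈GF))
                (GF-* (GF-* E₁∈GF E₂∈GF) r₁∈GF)
      where
      E₁∈GF : GF K m E₁
      E₁∈GF = GF-^ j d₁∈GF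
      E₂∈GF : GF K m E₂
      E₂∈GF = GF-^ j d₂∈GF

  PrimitiveCubeRoot : Carrier → Set ℓ
  PrimitiveCubeRoot ω = ω * ω + ω + 1# ≈ 0#

  primitive-cube-root : AlgClosed K → 0# ≉ 1# → ∃ PrimitiveCubeRoot
  primitive-cube-root closed 0≉1 with closed 1# (1# ∷ []) 1# (0≉1 ∘ sym)
  ... | ω , root = ω , trans (solve 1 (λ ω → ω :* ω :+ ω :+ :1 := :1 :+ ω :* (:1 :+ ω :* (:1 :+ ω :* :0))) refl ω) root

  cube-root : AlgClosed K → 0# ≉ 1# → ∀ r → ∃ λ t → t ^ 3 ≈ r
  cube-root closed 0≉1 r with closed r (0# ∷ 0# ∷ []) 1# (0≉1 ∘ sym)
  ... | t , root = t , x+y≈0⇒x≈y (trans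
    (solve 2 (λ t r → t :* (t :* (t :* :1)) :+ r := r :+ t :* (:0 :+ t :* (:0 :+ t :* (:1 :+ t :* :0)))) refl t r) root)

  ω^3≈1 : ∀ {ω} → PrimitiveCubeRoot ω → ω ^ 3 ≈ 1#
  ω^3≈1 {ω} ω²+ω+1≈0 = ≈-modulo
    (solve 1 (λ ω → ω :* (ω :* (ω :* :1)) := :1 :+ (ω :+ :1) :* (ω :* ω :+ ω :+ :1)) refl ω)
    (_ *₀ ω²+ω+1≈0)

  -- In characteristic 2 this says x = s + s⁻¹ for s = ω² x + y.
  unit-sum : ∀ {ω x y} → PrimitiveCubeRoot ω → CofactorRoot x y → (ω * ω * x + y) * (ω * ω * x + y + x) ≈ 1#
  unit-sum {ω} {x} {y} ω²+ω+1≈0 cofactor = ≈-modulo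
    (solve 3 (λ ω x y → (ω :* ω :* x :+ y) :* (ω :* ω :* x :+ y :+ x)
                        := :1 :+ ((y :* y :+ x :* y :+ x :* x :+ :1) :+ x :* x :* (ω :* ω :+ ω :+ :1) :* (ω :* ω :+ ω :+ :1)))
           refl ω x y)
    (cofactor +₀ _ *₀ ω²+ω+1≈0)

  -- Cardano's formula: in characteristic 2, z³ + z at z = t + u is t³ + u³ when t u = 1.
  cardano : ∀ {ω t u c} → PrimitiveCubeRoot ω → t * u ≈ 1# → t ^ 3 + u ^ 3 ≈ c →
            CubicRoots c (t + u) (ω * t + ω * ω * u) (ω * ω * t + ω * u)
  cardano {ω} {t} {u} ω²+ω+1≈0 tu≈1 t³+u³≈c = record
    { e₁≈0 = trans
        (solve 3 (λ ω t u → (t :+ u) :+ (ω :* t :+ ω :* ω :* u) :+ (ω :* ω :* t :+ ω :* u)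
                            := (t :+ u) :* (ω :* ω :+ ω :+ :1)) refl ω t u)
        (_ *₀ ω²+ω+1≈0)
    ; e₂≈1 = ≈-modulo
        (solve 3 (λ ω t u → (t :+ u) :* (ω :* t :+ ω :* ω :* u) :+ (t :+ u) :* (ω :* ω :* t :+ ω :* u)
                            :+ (ω :* t :+ ω :* ω :* u) :* (ω :* ω :* t :+ ω :* u)
                            := :1 :+ ((t :* u :+ :1)
                                      :+ (ω :* (t :* t :+ u :* u) :+ t :* u :* (ω :* ω :+ ω :+ :1)) :* (ω :* ω :+ ω :+ :1)))
               refl ω t u)
        (x≈y⇒x+y≈0 tu≈1 +₀ _ *₀ ω²+ω+1≈0)
    ; e₃≈c = trans (≈-modulo
        (solve 3 (λ ω t u → (t :+ u) :* (ω :* t :+ ω :* ω :* u) :* (ω :* ω :* t :+ ω :* u)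
                            := t :* (t :* (t :* :1)) :+ u :* (u :* (u :* :1))
                               :+ (t :+ u) :* ((ω :+ :1) :* (t :* t :+ u :* u) :+ t :* u :* (ω :* ω :+ ω :+ :1))
                                  :* (ω :* ω :+ ω :+ :1))
               refl ω t u)
        (_ *₀ ω²+ω+1≈0)) t³+u³≈c
    }

  cardano-splitting : AlgClosed K → 0# ≉ 1# → ∀ m {k ω r r′ c} → 2 ℕ.^ m ≡ suc (3 ℕ.* k) → PrimitiveCubeRoot ω →
                      GF K m r → GF K m r′ → r * r′ ≈ 1# → r + r′ ≈ c → CubicSplitting c (3 ℕ.* m)
  cardano-splitting closed 0≉1 m {k} {ω} {r} {r′} q≡ ω²+ω+1≈0 r∈GF r′∈GF rr′≈1 r+r′≈c
    with cube-root closed 0≉1 r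
  ... | t , t³≈r = record
    { r₁∈GF = GF-+ t∈GF u∈GF
    ; r₂∈GF = GF-+ (GF-* ω∈GF t∈GF) (GF-* (GF-* ω∈GF ω∈GF) u∈GF)
    ; r₃∈GF = GF-+ (GF-* (GF-* ω∈GF ω∈GF) t∈GF) (GF-* ω∈GF u∈GF)
    ; roots = cardano ω²+ω+1≈0 tu≈1 (trans (+-cong t³≈r u³≈r′) r+r′≈c)
    }
    where
    module GFq = Subfield m
    open Subfield₂ (3 ℕ.* m)

    u : Carrier
    u = t * t * r′

    tu≈1 : t * u ≈ 1#
    tu≈1 = begin
      t * (t * t * r′)  ≈⟨ solve 2 (λ t r′ → t :* (t :* t :* r′) := t :* (t :* (t :* :1)) :* r′) refl t r′ ⟩
      t ^ 3 * r′        ≈⟨ *-congʳ t³≈r ⟩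
      r * r′            ≈⟨ rr′≈1 ⟩
      1#                ∎

    u³≈r′ : u ^ 3 ≈ r′
    u³≈r′ = begin
      u ^ 3                 ≈⟨ *-identityʳ _ ⟨
      u ^ 3 * 1#            ≈⟨ *-congˡ rr′≈1 ⟨
      u ^ 3 * (r * r′)      ≈⟨ *-congˡ (*-congʳ t³≈r) ⟨
      u ^ 3 * (t ^ 3 * r′)  ≈⟨ trans (*-congʳ (*-comm (t ^ 3) (u ^ 3))) (*-assoc (u ^ 3) (t ^ 3) r′) ⟨
      t ^ 3 * u ^ 3 * r′    ≈⟨ *-congʳ (^-distrib-* t u 3) ⟨
      (t * u) ^ 3 * r′      ≈⟨ *-congʳ (trans (^-congˡ 3 tu≈1) (1^n≈1 3)) ⟩
      1# * r′               ≈⟨ *-identityˡ r′ ⟩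
      r′                    ∎

    ω∈GF : GF K (3 ℕ.* m) ω
    ω∈GF = GFq.GF-⊆-* 3 (GFq.root-of-unity-∈GF 3 {k} q≡ (ω^3≈1 ω²+ω+1≈0))

    t∈GF : GF K (3 ℕ.* m) t
    t∈GF = GFq.root-of-unit-∈GF 3 {k} q≡ r∈GF (trans (*-comm r′ r) rr′≈1) t³≈r

    u∈GF : GF K (3 ℕ.* m) u
    u∈GF = GF-* (GF-* t∈GF t∈GF) (GFq.GF-⊆-* 3 r′∈GF)

  unit-sum-∈GF : ∀ m {k ω x y} e → 2 ℕ.^ m ≡ suc (3 ℕ.* k) → PrimitiveCubeRoot ω → GF K m x → GF K m y →
                 CofactorRoot x y → ∃₂ λ r r′ → GF K m r × GF K m r′ × r * r′ ≈ 1# × r + r′ ≈ x ^ 2 ℕ.^ e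
  unit-sum-∈GF m {k} {ω} {x} {y} e q≡ ω²+ω+1≈0 x∈GF y∈GF cofactor =
    s ^ N , s′ ^ N , GF-^ N s∈GF , GF-^ N s′∈GF , rr′≈1 , sym x^N≈r+r′
    where
    open Subfield₂ m

    N : ℕ
    N = 2 ℕ.^ e

    s s′ : Carrier
    s = ω * ω * x + y
    s′ = s + x

    s∈GF : GF K m s
    s∈GF = GF-+ (GF-* (GF-* ω∈GF ω∈GF) x∈GF) y∈GF
      where
      ω∈GF : GF K m ω
      ω∈GF = root-of-unity-∈GF 3 {k} q≡ (ω^3≈1 ω²+ω+1≈0)

    s′∈GF : GF K m s′
    s′∈GF = GF-+ s∈GF x∈GF

    rr′≈1 : s ^ N * s′ ^ N ≈ 1#
    rr′≈1 = trans (sym (^-distrib-* s s′ N)) (trans (^-congˡ N (unit-sum ω²+ω+1≈0 cofactor)) (1^n≈1 N))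

    x^N≈r+r′ : x ^ N ≈ s ^ N + s′ ^ N
    x^N≈r+r′ = trans (^-congˡ N (solve 2 (λ s x → x := s :+ (s :+ x)) refl s x)) (frobenius s s′ e)

  splits-in-cubic-extension : 0# ≉ 1# → AlgClosed K → ∀ m {k c x} → 2 ℕ.^ m ≡ 1 ℕ.+ 3 ℕ.* suc k → ∀ e →
    SplitsIn K (cubic c) m → GF K m x → eval K (cubic c) x ≈ 0# → SplitsIn K (cubic (x ^ 2 ℕ.^ e)) (3 ℕ.* m)
  splits-in-cubic-extension 0≉1 closed m {k} q≡ e split x∈GF root =
    let (y , y∈GF , cofactor) = cofactor-root-∈GF q≡ (splitsIn⇒cubicSplitting 0≉1 m split) x∈GF root
        (ω , ω²+ω+1≈0) = primitive-cube-root closed 0≉1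
        (r , r′ , r∈GF , r′∈GF , rr′≈1 , r+r′≈x^N) =
          unit-sum-∈GF m {suc k} e q≡ ω²+ω+1≈0 x∈GF y∈GF cofactor
    in cubicSplitting⇒splitsIn
         (cardano-splitting closed 0≉1 m {suc k} q≡ ω²+ω+1≈0 r∈GF r′∈GF rr′≈1 r+r′≈x^N)

open import Data.Nat using (_≤_; _*_; _^_; _∸_; _+_)
open import Data.Nat.Tactic.RingSolver using (solve-∀)
open ≡.≡-Reasoning

4^[1+n]≡1+3*[1+k] : ∀ n → ∃ λ k → 4 ^ suc n ≡ 1 + 3 * suc k
4^[1+n]≡1+3*[1+k] zero = 0 , ≡.refl
4^[1+n]≡1+3*[1+k] (suc n) =
  let (k , 4^[1+n]≡) = 4^[1+n]≡1+3*[1+k] n in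
  4 * suc k , (begin
    4 * 4 ^ suc n        ≡⟨ ≡.cong (4 *_) 4^[1+n]≡ ⟩
    4 * (1 + 3 * suc k)  ≡⟨ rearrange k ⟩
    1 + 3 * suc (4 * suc k) ∎)
  where
  rearrange : ∀ k → 4 * (1 + 3 * suc k) ≡ 1 + 3 * suc (4 * suc k)
  rearrange = solve-∀

2^[2*3^n]≡1+3*[1+k] : ∀ n → ∃ λ k → 2 ^ (2 * 3 ^ n) ≡ 1 + 3 * suc k
2^[2*3^n]≡1+3*[1+k] n =
  let (k , 4^[1+p]≡) = 4^[1+n]≡1+3*[1+k] (ℕ.pred (3 ^ n)) in
  k , (begin
    2 ^ (2 * 3 ^ n)           ≡⟨ ℕ.^-*-assoc 2 2 (3 ^ n) ⟨
    4 ^ 3 ^ n                 ≡⟨ ≡.cong (4 ^_) (ℕ.suc-pred (3 ^ n) {{ℕ.m^n≢0 3 n}}) ⟨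
    4 ^ suc (ℕ.pred (3 ^ n))  ≡⟨ 4^[1+p]≡ ⟩
    1 + 3 * suc k             ∎)

2*3^[n+1]≡3*[2*3^n] : ∀ n → 2 * 3 ^ (n + 1) ≡ 3 * (2 * 3 ^ n)
2*3^[n+1]≡3*[2*3^n] n = begin
  2 * 3 ^ (n + 1)    ≡⟨ ≡.cong (λ i → 2 * 3 ^ i) (ℕ.+-comm n 1) ⟩
  2 * (3 * 3 ^ n)    ≡⟨ swap (3 ^ n) ⟩
  3 * (2 * 3 ^ n)    ∎
  where
  swap : ∀ x → 2 * (3 * x) ≡ 3 * (2 * x)
  swap = solve-∀

lemma6p2 : ∀ {c ℓ : Level} (K : CommutativeRing c ℓ) →
    IsField K → CharTwo K → AlgClosed K →
    (e n : ℕ) → 2 ≤ n →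
    (xₙ₋₁ xₙ : CommutativeRing.Carrier K) →
    GF K (2 * 3 ^ (n ∸ 1)) xₙ₋₁ →
    SplitsIn K (f K e xₙ₋₁) (2 * 3 ^ n) →
    GF K (2 * 3 ^ n) xₙ →
    CommutativeRing._≈_ K (eval K (f K e xₙ₋₁) xₙ) (CommutativeRing.0# K) →
    SplitsIn K (f K e xₙ) (2 * 3 ^ (n + 1))
lemma6p2 K (0≉1 , _) char2 closed e n _ _ xₙ _ split xₙ∈GF root =
  let (_ , q≡) = 2^[2*3^n]≡1+3*[1+k] n in
  ≡.subst (SplitsIn K (f K e xₙ)) (≡.sym (2*3^[n+1]≡3*[2*3^n] n))
    (splits-in-cubic-extension 0≉1 closed (2 * 3 ^ n) q≡ e split xₙ∈GF root)
  where open CharacteristicTwo K char2
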